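{- Let $M$ be a sharp, integral monoid and let $\Gamma=(X,r,i,l)$ be an $M$-metrised graph. Then $\operatorname{dgon}(\Gamma)\le \operatorname{ggon}(\Gamma)$.
   Context: Monoids are commutative with identity $0$; $M$ is sharp if $0$ is its only invertible element and integral if $a+c=b+c\Rightarrow a=b$; $M^{gp}$ is its groupification, into which $M$ embeds. A graph is $(X,r,i)$ with $X$ finite, $r:X\to X$ idempotent, $i:X\to X$ an involution, and $i(x)=x \iff r(x)=x$. Vertices $V$ are the fixed points of $i$, half-edges are $H=X\setminus V$, edges are the pairs $\{e,i(e)\}$, $e\in H$; $r(e)$ is the root of $e$ and $H_v=\{e\in H: r(e)=v\}$. All graphs are connected. An $M$-metrised graph is a graph together with $l:X\to M$ such that $l(i(x))=l(x)$ and $l(x)=0\iff x\in V$. A divisor is an element $D=\sum_v D(v)[v]$ of the free abelian group $\operatorname{Div}(\Gamma)$ on $V$; $\deg D=\sum_v D(v)$; $D\ge D'$ means $D(v)\ge D'(v)$ for all $v$; $\operatorname{Div}_+^k(\Gamma)$ is the set of effective ($\ge 0$) divisors of degree $k$. $\operatorname{PL}(\Gamma)$ is the group of $g:V\to M^{gp}$ with $g(r(e))-g(r(i(e)))\in\langle l(e)\rangle$ (the subgroup generated by $l(e)$) for all $e\in H$; for such $g$ the integer $\frac{g(r(e))-g(r(i(e)))}{l(e)}$ is well defined. The Laplacian is $\Delta(g)=\sum_{v\in V}\sum_{e\in H_v}\frac{g(v)-g(r(i(e)))}{l(e)}[v]$; $\operatorname{Prin}(\Gamma)=\Delta(\operatorname{PL}(\Gamma))$;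 $D\sim D'$ iff $D-D'\in\operatorname{Prin}(\Gamma)$; $|D|=\{E\ge 0: E\sim D\}$; the rank is $r(D)=\max\{k\in\mathbb Z: |D-F|\neq\emptyset \text{ for all } F\in\operatorname{Div}_+^k(\Gamma)\}$; $\operatorname{dgon}(\Gamma)=\min\{\deg D: r(D)\ge 1\}$. A morphism $\phi:\Gamma\to\Gamma'=(X',r',i',l')$ of $M$-metrised graphs is a map $\phi:X\to X'$ with $\phi(V)\subseteq V'$; if $e\in H$ and $\phi(e)=e'\in H'$ then $\phi(r(e))=r'(e')$, $\phi(r(i(e)))=r'(i'(e'))$ and $l'(e')\in\langle l(e)\rangle$; if $\phi(e)=v'\in V'$ then $\phi(r(e))=\phi(r(i(e)))=v'$. The slope $\mu_\phi(e)$ is the positive integer $l'(\phi(e))/l(e)$ if $\phi(e)\in H'$ and $0$ otherwise. For $v\in V$ and $e'\in H'_{\phi(v)}$, $m_{\phi,v}(e')=\sum_{e\in H_v,\phi(e)=e'}\mu_\phi(e)$. $\phi$ is harmonic (horizontally conformal) if for each $v$, $m_{\phi,v}(e')$ is independent of $e'\in H'_{\phi(v)}$; this common value is $m_\phi(v)$. Then $\sum_{v:\phi(v)=r'(e')}m_{\phi,v}(e')$ is independent of $e'\in H'$ and is called $\deg\phi$. A harmonic $\phi$ is non-degenerate if $m_\phi(v)>0$ for all $v\in V$. A tree is a graph without cycles. $\operatorname{ggon}(\Gamma)$ is the minimum of $\deg\phi$ over all $M$-metrised trees $T$ and harmonic non-degenerate morphisms $\phi:\Gamma\to T$, and $\infty$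 if no such morphism exists. -}

module Defs where

open import Level using (_⊔_)
open import Algebra.Bundles using (CommutativeMonoid)
open import Data.Nat as ℕ using (ℕ; zero; suc)
open import Data.Integer as ℤ using (ℤ; +_; -[1+_]; 0ℤ; 1ℤ)
open import Data.Fin using (Fin; zero; suc; inject₁; fromℕ)
open import Data.Fin.Properties using () renaming (_≟_ to _≟ᶠ_)
open import Data.Product using (Σ; _×_; _,_)
open import Data.Sum using (_⊎_)
open import Data.Bool using (Bool; true; false; if_then_else_; _∧_; not)
open import Relation.Nullary using (¬_)
open import Relation.Nullary.Decidable using (⌊_⌋)
open import Relation.Binary.PropositionalEquality using (_≡_; _≢_)

sumFin : (n : ℕ) → (Fin n → ℤ) → ℤ
sumFin zero    f = 0ℤ
sumFin (suc n) f = f zero ℤ.+ sumFin n (λ x → f (suc x))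

module _ {c ℓ} (M : CommutativeMonoid c ℓ) where
  open CommutativeMonoid M renaming (Carrier to A)

  IsSharp : Set (c ⊔ ℓ)
  IsSharp = ∀ a b → a ∙ b ≈ ε → a ≈ ε

  IsIntegral : Set (c ⊔ ℓ)
  IsIntegral = ∀ a b d → a ∙ d ≈ b ∙ d → a ≈ b

  -- Groupification M^gp of an integral monoid: formal differences (a , b)
  -- meaning a - b, with (a , b) ≈gp (a' , b') iff a + b' = a' + b.

  GP : Set c
  GP = A × A

  _≈gp_ : GP → GP → Set ℓ
  (a , b) ≈gp (a' , b') = (a ∙ b') ≈ (a' ∙ b)

  _-gp_ : GP → GP → GP
  (a , b) -gp (a' , b') = (a ∙ b' , b ∙ a')

  ιgp : A → GP
  ιgp a = (a , ε)

  times : ℕ → A → A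
  times zero    a = ε
  times (suc n) a = a ∙ times n a

  -- k • a ∈ M^gp for k ∈ ℤ ; the subgroup ⟨a⟩ is {zmul k a | k ∈ ℤ}
  zmul : ℤ → A → GP
  zmul (+ n)     a = (times n a , ε)
  zmul -[1+ n ]  a = (ε , times (suc n) a)

  record MGraph : Set (c ⊔ ℓ) where
    field
      size    : ℕ
      r       : Fin size → Fin size
      i       : Fin size → Fin size
      r-idem  : ∀ x → r (r x) ≡ r x
      i-invol : ∀ x → i (i x) ≡ x
      fixed   : ∀ x → (i x ≡ x → r x ≡ x) × (r x ≡ x → i x ≡ x)
      l       : Fin size → A
      l-sym   : ∀ x → l (i x) ≈ l x
      l-zero  : ∀ x → (l x ≈ ε → i x ≡ x) × (i x ≡ x → l x ≈ ε)

    IsVertex : Fin size → Set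
    IsVertex x = i x ≡ x

    IsHalfEdge : Fin size → Set
    IsHalfEdge x = ¬ (i x ≡ x)

    isVertex? : Fin size → Bool
    isVertex? x = ⌊ i x ≟ᶠ x ⌋

    _==_ : Fin size → Fin size → Bool
    x == y = ⌊ x ≟ᶠ y ⌋

    data Reach (u : Fin size) : Fin size → Set where
      here : Reach u u
      step : ∀ e → IsHalfEdge e → Reach u (r e) → Reach u (r (i e))

    Connected : Set
    Connected = ∀ u v → IsVertex u → IsVertex v → Reach u v

    record Cycle (k : ℕ) : Set where
      field
        es       : Fin (suc k) → Fin size
        half     : ∀ j → IsHalfEdge (es j)
        linked   : ∀ (j : Fin k) → r (i (es (inject₁ j))) ≡ r (es (suc j))
        closed   : r (i (es (fromℕ k))) ≡ r (es zero)
        vtx-inj  : ∀ j j' → r (es j) ≡ r (es j') → j ≡ j'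
        edge-inj : ∀ j j' → (es j ≡ es j') ⊎ (es j ≡ i (es j')) → j ≡ j'

    HasCycle : Set
    HasCycle = Σ ℕ Cycle

    -- Divisors: functions X → ℤ, only their values on V matter
    Div : Set
    Div = Fin size → ℤ

    deg : Div → ℤ
    deg D = sumFin size (λ x → if isVertex? x then D x else 0ℤ)

    Effective : Div → Set
    Effective D = ∀ v → IsVertex v → 0ℤ ℤ.≤ D v

    _-D_ : Div → Div → Div
    (D -D D') x = D x ℤ.- D' x

    -- piecewise linear functions g : V → M^gp ; the (unique) integer
    -- (g(r e) - g(r(i e))) / l(e) is recorded as `slope e`.
    record PL : Set (c ⊔ ℓ) where
      field
        g          : Fin size → GP
        slope      : Fin size → ℤ
        slope-spec : ∀ e → IsHalfEdge e →
                     (g (r e) -gp g (r (i e))) ≈gp zmul (slope e) (l e)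

    Laplacian : PL → Div
    Laplacian φ v = sumFin size (λ e →
      if not (isVertex? e) ∧ (r e == v) then PL.slope φ e else 0ℤ)

    _∼_ : Div → Div → Set (c ⊔ ℓ)
    D ∼ D' = Σ PL (λ φ → ∀ v → IsVertex v → (D -D D') v ≡ Laplacian φ v)

    LinSysNonempty : Div → Set (c ⊔ ℓ)
    LinSysNonempty D = Σ Div (λ E → Effective E × (E ∼ D))

    RankCond : Div → ℤ → Set (c ⊔ ℓ)
    RankCond D k = ∀ F → Effective F → deg F ≡ k → LinSysNonempty (D -D F)

    -- r(D) ≥ k  (r(D) is the maximum of the k satisfying RankCond)
    RankGe : Div → ℤ → Set (c ⊔ ℓ)
    RankGe D k = Σ ℤ (λ k' → (k ℤ.≤ k') × RankCond D k')

    DgonLe : ℤ → Set (c ⊔ ℓ)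
    DgonLe d = Σ Div (λ D → RankGe D 1ℤ × (deg D ℤ.≤ d))

  IsTree : MGraph → Set
  IsTree T = MGraph.Connected T × ¬ MGraph.HasCycle T

  record Morphism (Γ Γ' : MGraph) : Set (c ⊔ ℓ) where
    private
      module G  = MGraph Γ
      module G' = MGraph Γ'
    field
      φ        : Fin G.size → Fin G'.size
      vert     : ∀ v → G.IsVertex v → G'.IsVertex (φ v)
      μ        : Fin G.size → ℤ
      on-edge  : ∀ e → G.IsHalfEdge e → G'.IsHalfEdge (φ e) →
                   (φ (G.r e) ≡ G'.r (φ e))
                 × (φ (G.r (G.i e)) ≡ G'.r (G'.i (φ e)))
                 × (ιgp (G'.l (φ e)) ≈gp zmul (μ e) (G.l e))
      on-vert  : ∀ e → G.IsHalfEdge e → G'.IsVertex (φ e) →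
                   (φ (G.r e) ≡ φ e) × (φ (G.r (G.i e)) ≡ φ e)
      μ-zero   : ∀ e → G'.IsVertex (φ e) → μ e ≡ 0ℤ

    mult : Fin G.size → Fin G'.size → ℤ
    mult v e' = sumFin G.size (λ e →
      if not (G.isVertex? e) ∧ (G.r e G.== v) ∧ (φ e G'.== e')
      then μ e else 0ℤ)

    Harmonic : Set
    Harmonic = Σ (Fin G.size → ℤ) (λ m →
      ∀ v → G.IsVertex v → ∀ e' → G'.IsHalfEdge e' → G'.r e' ≡ φ v →
        mult v e' ≡ m v)

    NonDegenerate : Harmonic → Set
    NonDegenerate (m , _) = ∀ v → G.IsVertex v → 0ℤ ℤ.< m v

    IsDegree : ℤ → Set
    IsDegree d = Σ (Fin G'.size) G'.IsHalfEdge
               × (∀ e' → G'.IsHalfEdge e' →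
                    sumFin G.size (λ v →
                      if G.isVertex? v ∧ (φ v G'.== G'.r e')
                      then mult v e' else 0ℤ) ≡ d)

  GgonLe : MGraph → ℤ → Set (c ⊔ ℓ)
  GgonLe Γ d = Σ MGraph (λ T → IsTree T × Σ (Morphism Γ T) (λ ψ →
    Σ (Morphism.Harmonic ψ) (λ h → Morphism.NonDegenerate ψ h
      × Morphism.IsDegree ψ d)))

module Submission where

-- A harmonic non-degenerate φ : Γ → T of degree d pulls each vertex a of the tree back to the
-- effective divisor φ*[a] = Σ_{φ(v) = a} m_φ(v)[v] of degree d. For a half-edge e' of T, the function
-- on T equal to l(e') at the vertices reachable from r(e') without crossing e' and 0 elsewhere has
-- slope 1 on e' and 0 on every other edge, because T has no cycles; by harmonicity its pullback is a
-- piecewise linear function on Γ with Laplacian φ*[r e'] − φ*[r (i e')]. As T is connected, all the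
-- φ*[a] are therefore linearly equivalent, and φ*[φ v] ≥ [v] by non-degeneracy, so r(φ*[a]) ≥ 1.

open import Algebra.Bundles using (CommutativeMonoid)
open import Data.Bool using (Bool; true; false; if_then_else_; _∧_; not)
open import Data.Bool.Properties using (if-eta)
open import Data.Empty using (⊥-elim)
open import Data.Fin using (Fin; zero; suc; inject₁; fromℕ)
open import Data.Fin.Properties using (any?; injective⇒≤; suc-injective) renaming (_≟_ to _≟ᶠ_)
open import Data.Integer as ℤ using (ℤ; +_; -[1+_]; 0ℤ; 1ℤ; _+_; _-_; -_; _⊖_)
import Data.Integer.Properties as ℤP
open import Data.Integer.Solver using (module +-*-Solver)
open import Data.Nat as ℕ using (ℕ; zero; suc; z≤n; s≤s)
import Data.Nat.Properties as ℕP
open import Data.Product using (Σ; ∃; _×_; _,_; proj₁; proj₂; swap)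
open import Data.Sum using (_⊎_; inj₁; inj₂)
open import Function using (_∘_; mk⇔)
open import Function.Definitions using (Injective)
open import Relation.Binary.Bundles using (Setoid)
open import Relation.Binary.PropositionalEquality
  using (_≡_; _≢_; refl; sym; trans; cong; cong₂; subst; module ≡-Reasoning)
open import Relation.Nullary using (¬_; yes; no; does; ¬?)
open import Relation.Nullary.Decidable using (_×-dec_; _⊎-dec_; does-⇔; dec-true; dec-false)
open import Relation.Unary using (Decidable)

open import Defs

open +-*-Solver using (solve; _:+_; _:-_; _:=_)

sumFin-cong : ∀ n {f g : Fin n → ℤ} → (∀ j → f j ≡ g j) → sumFin n f ≡ sumFin n g
sumFin-cong zero    f≡g = refl
sumFin-cong (suc n) f≡g = cong₂ _+_ (f≡g zero) (sumFin-cong n (λ j → f≡g (suc j)))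

sumFin-zero : ∀ n {f : Fin n → ℤ} → (∀ j → f j ≡ 0ℤ) → sumFin n f ≡ 0ℤ
sumFin-zero zero    f≡0 = refl
sumFin-zero (suc n) f≡0 = cong₂ _+_ (f≡0 zero) (sumFin-zero n (λ j → f≡0 (suc j)))

sumFin-+ : ∀ n (f g : Fin n → ℤ) → sumFin n (λ j → f j + g j) ≡ sumFin n f + sumFin n g
sumFin-+ zero    f g = refl
sumFin-+ (suc n) f g = trans (cong (_+_ (f zero + g zero)) (sumFin-+ n (λ j → f (suc j)) (λ j → g (suc j))))
  (solve 4 (λ a b s t → (a :+ b) :+ (s :+ t) := (a :+ s) :+ (b :+ t)) refl
    (f zero) (g zero) (sumFin n (λ j → f (suc j))) (sumFin n (λ j → g (suc j))))

sumFin-neg : ∀ n (f : Fin n → ℤ) → sumFin n (λ j → - f j) ≡ - sumFin n f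
sumFin-neg zero    f = refl
sumFin-neg (suc n) f = trans (cong (_+_ (- f zero)) (sumFin-neg n (λ j → f (suc j))))
  (sym (ℤP.neg-distrib-+ (f zero) (sumFin n (λ j → f (suc j)))))

sumFin-- : ∀ n (f g : Fin n → ℤ) → sumFin n (λ j → f j - g j) ≡ sumFin n f - sumFin n g
sumFin-- n f g = trans (sumFin-+ n f (λ j → - g j)) (cong (_+_ (sumFin n f)) (sumFin-neg n g))

sumFin-nonneg : ∀ n {f : Fin n → ℤ} → (∀ j → 0ℤ ℤ.≤ f j) → 0ℤ ℤ.≤ sumFin n f
sumFin-nonneg zero    f≥0 = ℤP.≤-refl
sumFin-nonneg (suc n) f≥0 = ℤP.+-mono-≤ (f≥0 zero) (sumFin-nonneg n (λ j → f≥0 (suc j)))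

nonneg-+≡0 : ∀ {a b} → 0ℤ ℤ.≤ a → 0ℤ ℤ.≤ b → a + b ≡ 0ℤ → a ≡ 0ℤ × b ≡ 0ℤ
nonneg-+≡0 {+ 0} {+ 0} _ _ _ = refl , refl

nonneg-+≡1 : ∀ {a b} → 0ℤ ℤ.≤ a → 0ℤ ℤ.≤ b → a + b ≡ 1ℤ →
  (a ≡ 0ℤ × b ≡ 1ℤ) ⊎ (a ≡ 1ℤ × b ≡ 0ℤ)
nonneg-+≡1 {+ 0} {+ 1} _ _ _ = inj₁ (refl , refl)
nonneg-+≡1 {+ 1} {+ 0} _ _ _ = inj₂ (refl , refl)

sumFin-nonneg-≡0 : ∀ n {f : Fin n → ℤ} → (∀ j → 0ℤ ℤ.≤ f j) → sumFin n f ≡ 0ℤ → ∀ j → f j ≡ 0ℤ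
sumFin-nonneg-≡0 (suc n) f≥0 Σ≡0 j
  with nonneg-+≡0 (f≥0 zero) (sumFin-nonneg n (λ j → f≥0 (suc j))) Σ≡0
sumFin-nonneg-≡0 (suc n) f≥0 Σ≡0 zero    | f0≡0 , _ = f0≡0
sumFin-nonneg-≡0 (suc n) f≥0 Σ≡0 (suc j) | _ , rest≡0 =
  sumFin-nonneg-≡0 n (λ j → f≥0 (suc j)) rest≡0 j

sumFin-nonneg-≡1 : ∀ n {f : Fin n → ℤ} → (∀ j → 0ℤ ℤ.≤ f j) → sumFin n f ≡ 1ℤ →
  ∃ λ j → f j ≡ 1ℤ × (∀ j' → j' ≢ j → f j' ≡ 0ℤ)
sumFin-nonneg-≡1 (suc n) f≥0 Σ≡1
  with nonneg-+≡1 (f≥0 zero) (sumFin-nonneg n (λ j → f≥0 (suc j))) Σ≡1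
... | inj₂ (f0≡1 , rest≡0) = zero , f0≡1 , λ
  { zero 0≢0 → ⊥-elim (0≢0 refl)
  ; (suc j') _ → sumFin-nonneg-≡0 n (λ j → f≥0 (suc j)) rest≡0 j' }
... | inj₁ (f0≡0 , rest≡1) with sumFin-nonneg-≡1 n (λ j → f≥0 (suc j)) rest≡1
...   | j , fj≡1 , others≡0 = suc j , fj≡1 , λ
  { zero _ → f0≡0
  ; (suc j') j'≢j → others≡0 j' (λ j'≡j → j'≢j (cong suc j'≡j)) }

module GraphFacts {c ℓ} {M : CommutativeMonoid c ℓ} (Γ : MGraph M) where
  open MGraph Γ

  i-injective : ∀ {x y} → i x ≡ i y → x ≡ y
  i-injective {x} {y} ix≡iy = trans (sym (i-invol x)) (trans (cong i ix≡iy) (i-invol y))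

  i-halfEdge : ∀ {e} → IsHalfEdge e → IsHalfEdge (i e)
  i-halfEdge {e} e-half iie≡ie = e-half (trans (sym iie≡ie) (i-invol e))

  r-vertex : ∀ x → IsVertex (r x)
  r-vertex x = proj₂ (fixed (r x)) (r-idem x)

  if-vertex : ∀ {a} z → IsVertex z → (if isVertex? z then a else 0ℤ) ≡ a
  if-vertex z z-vertex with i z ≟ᶠ z
  ... | yes _      = refl
  ... | no z-edge  = ⊥-elim (z-edge z-vertex)

  if-vertex≡1 : ∀ {a} z → (if isVertex? z then a else 0ℤ) ≡ 1ℤ → IsVertex z
  if-vertex≡1 z ≡1 with i z ≟ᶠ z
  ... | yes z-vertex = z-vertex

  effective-degree-one : ∀ F → Effective F → deg F ≡ 1ℤ →
    ∃ λ v → IsVertex v × F v ≡ 1ℤ × (∀ z → IsVertex z → z ≢ v → F z ≡ 0ℤ)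
  effective-degree-one F F≥0 degF≡1 with sumFin-nonneg-≡1 size restricted≥0 degF≡1
    where
    restricted≥0 : ∀ z → 0ℤ ℤ.≤ (if isVertex? z then F z else 0ℤ)
    restricted≥0 z with i z ≟ᶠ z
    ... | yes z-vertex = F≥0 z z-vertex
    ... | no _         = ℤP.≤-refl
  ... | v , Fv≡1 , others≡0 =
    v , v-vertex , trans (sym (if-vertex v v-vertex)) Fv≡1 ,
    λ z z-vertex z≢v → trans (sym (if-vertex z z-vertex)) (others≡0 z z≢v)
    where
    v-vertex : IsVertex v
    v-vertex = if-vertex≡1 v Fv≡1

module Groupification {c ℓ} (M : CommutativeMonoid c ℓ) (integral : IsIntegral M) where
  open CommutativeMonoid M renaming (refl to ≈-refl; sym to ≈-sym; trans to ≈-trans)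
  open import Algebra.Properties.CommutativeSemigroup commutativeSemigroup
    using (interchange; xy∙z≈xz∙y; x∙yz≈yx∙z; x∙yz≈y∙xz)

  infix  4 _≈ᵍ_
  infixl 6 _+ᵍ_ _-ᵍ_

  _≈ᵍ_ : GP M → GP M → Set ℓ
  _≈ᵍ_ = _≈gp_ M

  _-ᵍ_ : GP M → GP M → GP M
  _-ᵍ_ = _-gp_ M

  _+ᵍ_ : GP M → GP M → GP M
  (a , b) +ᵍ (a' , b') = (a ∙ a' , b ∙ b')

  -- Transitivity is where integrality is needed: the middle term has to be cancelled.
  ≈ᵍ-trans : ∀ {P Q R} → P ≈ᵍ Q → Q ≈ᵍ R → P ≈ᵍ R
  ≈ᵍ-trans {a , b} {a' , b'} {a'' , b''} P≈Q Q≈R = integral _ _ b' (begin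
    (a ∙ b'') ∙ b'  ≈⟨ xy∙z≈xz∙y a b'' b' ⟩
    (a ∙ b') ∙ b''  ≈⟨ ∙-congʳ P≈Q ⟩
    (a' ∙ b) ∙ b''  ≈⟨ xy∙z≈xz∙y a' b b'' ⟩
    (a' ∙ b'') ∙ b  ≈⟨ ∙-congʳ Q≈R ⟩
    (a'' ∙ b') ∙ b  ≈⟨ xy∙z≈xz∙y a'' b' b ⟩
    (a'' ∙ b) ∙ b'  ∎)
    where open import Relation.Binary.Reasoning.Setoid setoid

  gpSetoid : Setoid c ℓ
  gpSetoid = record
    { Carrier = GP M
    ; _≈_ = _≈ᵍ_
    ; isEquivalence = record
      { refl = ≈-refl
      ; sym = ≈-sym
      ; trans = ≈ᵍ-trans
      }
    }

  ≈⇒≈ᵍ : ∀ {a b a' b'} → a ≈ a' → b ≈ b' → (a , b) ≈ᵍ (a' , b')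
  ≈⇒≈ᵍ a≈a' b≈b' = ∙-cong a≈a' (≈-sym b≈b')

  +ᵍ-cong : ∀ {P P' Q Q'} → P ≈ᵍ P' → Q ≈ᵍ Q' → P +ᵍ Q ≈ᵍ P' +ᵍ Q'
  +ᵍ-cong {a , b} {a' , b'} {c , d} {c' , d'} P≈P' Q≈Q' = begin
    (a ∙ c) ∙ (b' ∙ d')  ≈⟨ interchange a c b' d' ⟩
    (a ∙ b') ∙ (c ∙ d')  ≈⟨ ∙-cong P≈P' Q≈Q' ⟩
    (a' ∙ b) ∙ (c' ∙ d)  ≈⟨ interchange a' b c' d ⟩
    (a' ∙ c') ∙ (b ∙ d)  ∎
    where open import Relation.Binary.Reasoning.Setoid setoid

  swap-cong : ∀ {P Q} → P ≈ᵍ Q → swap P ≈ᵍ swap Q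
  swap-cong {a , b} {a' , b'} P≈Q = ≈-trans (comm b a') (≈-trans (≈-sym P≈Q) (comm a b'))

  -ᵍ-+ᵍ-interchange : ∀ P Q P' Q' → (P +ᵍ Q) -ᵍ (P' +ᵍ Q') ≈ᵍ (P -ᵍ P') +ᵍ (Q -ᵍ Q')
  -ᵍ-+ᵍ-interchange (a , b) (c , d) (a' , b') (c' , d') =
    ≈⇒≈ᵍ (interchange a c b' d') (interchange b d a' c')

  -ᵍ-self : ∀ P → P -ᵍ P ≈ᵍ ιgp M ε
  -ᵍ-self (a , b) = ≈-trans (identityʳ _) (≈-trans (comm a b) (≈-sym (identityˡ _)))

  -ᵍ-identityʳ : ∀ P → P -ᵍ ιgp M ε ≈ᵍ P
  -ᵍ-identityʳ (a , b) = ≈⇒≈ᵍ (identityʳ a) (identityʳ b)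

  -ᵍ-anticomm : ∀ P Q → Q -ᵍ P ≈ᵍ swap (P -ᵍ Q)
  -ᵍ-anticomm (a , b) (a' , b') = ≈⇒≈ᵍ (comm a' b) (comm b' a)

  times-+ : ∀ m n a → times M (m ℕ.+ n) a ≈ times M m a ∙ times M n a
  times-+ zero    n a = ≈-sym (identityˡ _)
  times-+ (suc m) n a = ≈-trans (∙-congˡ (times-+ m n a)) (≈-sym (assoc _ _ _))

  zmul-neg : ∀ k a → zmul M (- k) a ≡ swap (zmul M k a)
  zmul-neg (+ zero)  a = refl
  zmul-neg (+ suc n) a = refl
  zmul-neg -[1+ n ]  a = refl

  zmul-⊖ : ∀ m n a → zmul M (m ⊖ n) a ≈ᵍ (times M m a , times M n a)
  zmul-⊖ m       zero    a = ≈-refl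
  zmul-⊖ zero    (suc n) a = ≈-refl
  zmul-⊖ (suc m) (suc n) a rewrite ℤP.[1+m]⊖[1+n]≡m⊖n m n =
    ≈ᵍ-trans {zmul M (m ⊖ n) a} (zmul-⊖ m n a) (x∙yz≈yx∙z (times M m a) a (times M n a))

  zmul-+ : ∀ k k' a → zmul M (k + k') a ≈ᵍ zmul M k a +ᵍ zmul M k' a
  zmul-+ (+ m)     (+ n)     a = ≈⇒≈ᵍ (times-+ m n a) (≈-sym (identityˡ ε))
  zmul-+ (+ m)     -[1+ n ]  a = ≈ᵍ-trans {zmul M (m ⊖ suc n) a} (zmul-⊖ m (suc n) a)
    (≈⇒≈ᵍ (≈-sym (identityʳ _)) (≈-sym (identityˡ _)))
  zmul-+ -[1+ m ]  (+ n)     a = ≈ᵍ-trans {zmul M (n ⊖ suc m) a} (zmul-⊖ n (suc m) a)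
    (≈⇒≈ᵍ (≈-sym (identityˡ _)) (≈-sym (identityʳ _)))
  zmul-+ -[1+ m ]  -[1+ n ]  a = ≈⇒≈ᵍ (≈-sym (identityˡ ε)) (begin
    a ∙ (a ∙ times M (m ℕ.+ n) a)          ≈⟨ ∙-congˡ (∙-congˡ (times-+ m n a)) ⟩
    a ∙ (a ∙ (times M m a ∙ times M n a))  ≈⟨ ∙-congˡ (x∙yz≈y∙xz a _ _) ⟩
    a ∙ (times M m a ∙ (a ∙ times M n a))  ≈⟨ ≈-sym (assoc _ _ _) ⟩
    (a ∙ times M m a) ∙ (a ∙ times M n a)  ∎)
    where open import Relation.Binary.Reasoning.Setoid setoid

module LinearEquivalence {c ℓ} (M : CommutativeMonoid c ℓ) (integral : IsIntegral M) (Γ : MGraph M) where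
  open CommutativeMonoid M using (ε)
  open MGraph Γ
  open Groupification M integral

  PL-zero : PL
  PL-zero = record
    { g = λ _ → ιgp M ε ; slope = λ _ → 0ℤ ; slope-spec = λ _ _ → -ᵍ-self (ιgp M ε) }

  _+PL_ : PL → PL → PL
  p +PL q = record
    { g = λ z → P.g z +ᵍ Q.g z
    ; slope = λ e → P.slope e + Q.slope e
    ; slope-spec = λ e e-half → begin
        (P.g (r e) +ᵍ Q.g (r e)) -ᵍ (P.g (r (i e)) +ᵍ Q.g (r (i e)))
          ≈⟨ -ᵍ-+ᵍ-interchange (P.g (r e)) (Q.g (r e)) (P.g (r (i e))) (Q.g (r (i e))) ⟩
        (P.g (r e) -ᵍ P.g (r (i e))) +ᵍ (Q.g (r e) -ᵍ Q.g (r (i e)))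
          ≈⟨ +ᵍ-cong (P.slope-spec e e-half) (Q.slope-spec e e-half) ⟩
        zmul M (P.slope e) (l e) +ᵍ zmul M (Q.slope e) (l e)
          ≈⟨ zmul-+ (P.slope e) (Q.slope e) (l e) ⟨
        zmul M (P.slope e + Q.slope e) (l e)  ∎
    }
    where
    module P = PL p
    module Q = PL q
    open import Relation.Binary.Reasoning.Setoid gpSetoid

  Laplacian-zero : ∀ v → Laplacian PL-zero v ≡ 0ℤ
  Laplacian-zero v = sumFin-zero size λ e → if-eta (not (isVertex? e) ∧ (r e == v))

  Laplacian-+ : ∀ p q v → Laplacian (p +PL q) v ≡ Laplacian p v + Laplacian q v
  Laplacian-+ p q v = trans
    (sumFin-cong size λ e → if-+ (not (isVertex? e) ∧ (r e == v)))
    (sumFin-+ size _ _)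
    where
    if-+ : ∀ {s t} b → (if b then s + t else 0ℤ) ≡ (if b then s else 0ℤ) + (if b then t else 0ℤ)
    if-+ true  = refl
    if-+ false = refl

  ∼-refl : ∀ D → D ∼ D
  ∼-refl D = PL-zero , λ v _ → trans (ℤP.+-inverseʳ (D v)) (sym (Laplacian-zero v))

  ∼-trans : ∀ {D D' D''} → D ∼ D' → D' ∼ D'' → D ∼ D''
  ∼-trans {D} {D'} {D''} (p , Δp) (q , Δq) = p +PL q , λ v v-vertex → begin
    D v - D'' v                    ≡⟨ solve 3 (λ a b c → a :- c := (a :- b) :+ (b :- c)) refl (D v) (D' v) (D'' v) ⟩
    (D v - D' v) + (D' v - D'' v)  ≡⟨ cong₂ _+_ (Δp v v-vertex) (Δq v v-vertex) ⟩
    Laplacian p v + Laplacian q v  ≡⟨ Laplacian-+ p q v ⟨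
    Laplacian (p +PL q) v          ∎
    where open ≡-Reasoning

  ∼-−-congʳ : ∀ {D D'} F → D ∼ D' → (D -D F) ∼ (D' -D F)
  ∼-−-congʳ {D} {D'} F (p , Δp) = p , λ v v-vertex →
    trans (solve 3 (λ a b f → (a :- f) :- (b :- f) := a :- b) refl (D v) (D' v) (F v)) (Δp v v-vertex)

module TreeSides {c ℓ} {M : CommutativeMonoid c ℓ} (T : MGraph M) (acyclic : ¬ MGraph.HasCycle T)
                 (e : Fin (MGraph.size T)) (e-half : MGraph.IsHalfEdge T e) where
  open MGraph T
  open GraphFacts T

  AvoidsE : Fin size → Set
  AvoidsE f = IsHalfEdge f × f ≢ e × f ≢ i e

  avoidsE? : Decidable AvoidsE
  avoidsE? f = ¬? (i f ≟ᶠ f) ×-dec ¬? (f ≟ᶠ e) ×-dec ¬? (f ≟ᶠ i e)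

  avoidsE-i : ∀ {f} → AvoidsE f → AvoidsE (i f)
  avoidsE-i {f} (f-half , f≢e , f≢ie) =
    i-halfEdge f-half , (λ if≡e → f≢ie (trans (sym (i-invol f)) (cong i if≡e))) , f≢e ∘ i-injective

  data Walk : Fin size → Set where
    start : Walk (r e)
    step  : ∀ f → AvoidsE f → Walk (r f) → Walk (r (i f))

  length : ∀ {z} → Walk z → ℕ
  length start        = 0
  length (step _ _ p) = suc (length p)

  -- The visited vertices, most recent first.
  trail : ∀ {z} (p : Walk z) → Fin (suc (length p)) → Fin size
  trail start        zero    = r e
  trail (step f _ p) zero    = r (i f)
  trail (step f _ p) (suc j) = trail p j

  trail-head : ∀ {z} (p : Walk z) → trail p zero ≡ z
  trail-head start        = refl
  trail-head (step _ _ _) = refl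

  Simple : ∀ {z} → Walk z → Set
  Simple p = Injective _≡_ _≡_ (trail p)

  SimpleWalk : Fin size → Set
  SimpleWalk z = Σ (Walk z) Simple

  simple-start : Simple start
  simple-start {zero} {zero} _ = refl

  simple-tail : ∀ {f a} {p : Walk (r f)} → Simple (step f a p) → Simple p
  simple-tail simple eq = suc-injective (simple eq)

  simple-step : ∀ {f a} {p : Walk (r f)} → Simple p → (∀ j → r (i f) ≢ trail p j) → Simple (step f a p)
  simple-step simple fresh {zero}  {zero}   _  = refl
  simple-step simple fresh {zero}  {suc j'} eq = ⊥-elim (fresh j' eq)
  simple-step simple fresh {suc j} {zero}   eq = ⊥-elim (fresh j (sym eq))
  simple-step simple fresh {suc j} {suc j'} eq = cong suc (simple eq)

  simple-length : ∀ {z} (p : Walk z) → Simple p → length p ℕ.< size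
  simple-length p = injective⇒≤

  suffix : ∀ {z} (p : Walk z) j → Simple p → SimpleWalk (trail p j)
  suffix start        zero    simple = start , simple
  suffix (step f a p) zero    simple = step f a p , simple
  suffix (step f a p) (suc j) simple = suffix p j (simple-tail simple)

  -- Cut off the loop each time the walk revisits a vertex.
  shorten : ∀ {z} → Walk z → SimpleWalk z
  shorten start = start , simple-start
  shorten (step f a p) with shorten p
  ... | q , simple with any? (λ j → r (i f) ≟ᶠ trail q j)
  ...   | yes (j , revisit) = subst SimpleWalk (sym revisit) (suffix q j simple)
  ...   | no fresh          = step f a q , simple-step simple λ j eq → fresh (j , eq)

  -- The walk traversed backwards, closed up by the edge e.
  cycleEdges : ∀ {z} (p : Walk z) → Fin (suc (length p)) → Fin size
  cycleEdges start        zero    = e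
  cycleEdges (step f _ p) zero    = i f
  cycleEdges (step f _ p) (suc j) = cycleEdges p j

  r-cycleEdges : ∀ {z} (p : Walk z) j → r (cycleEdges p j) ≡ trail p j
  r-cycleEdges start        zero    = refl
  r-cycleEdges (step f _ p) zero    = refl
  r-cycleEdges (step f _ p) (suc j) = r-cycleEdges p j

  cycleEdges-last : ∀ {z} (p : Walk z) → cycleEdges p (fromℕ (length p)) ≡ e
  cycleEdges-last start        = refl
  cycleEdges-last (step _ _ p) = cycleEdges-last p

  cycleEdges-half : ∀ {z} (p : Walk z) j → IsHalfEdge (cycleEdges p j)
  cycleEdges-half start            zero    = e-half
  cycleEdges-half (step f avoids p) zero    = i-halfEdge (proj₁ avoids)
  cycleEdges-half (step f _ p)      (suc j) = cycleEdges-half p j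

  cycleEdges-linked : ∀ {z} (p : Walk z) (j : Fin (length p)) →
    r (i (cycleEdges p (inject₁ j))) ≡ r (cycleEdges p (suc j))
  cycleEdges-linked (step f _ p) zero    =
    trans (cong r (i-invol f)) (sym (trans (r-cycleEdges p zero) (trail-head p)))
  cycleEdges-linked (step f _ p) (suc j) = cycleEdges-linked p j

  cycleEdges-target : ∀ {z} (p : Walk z) j →
    cycleEdges p j ≡ e ⊎ ∃ λ k → r (i (cycleEdges p j)) ≡ trail p k
  cycleEdges-target start        zero    = inj₁ refl
  cycleEdges-target (step f _ p) zero    =
    inj₂ (suc zero , trans (cong r (i-invol f)) (sym (trail-head p)))
  cycleEdges-target (step f _ p) (suc j) with cycleEdges-target p j
  ... | inj₁ is-e       = inj₁ is-e
  ... | inj₂ (k , on-p) = inj₂ (suc k , on-p)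

  step-∉-cycleEdges : ∀ {f a} {p : Walk (r f)} → Simple (step f a p) → ∀ j → f ≢ cycleEdges p j
  step-∉-cycleEdges {f} {_ , f≢e , _} {p} simple j f≡c with cycleEdges-target p j
  ... | inj₁ c≡e       = f≢e (trans f≡c c≡e)
  ... | inj₂ (k , on-p) with simple {zero} {suc k} (trans (cong (r ∘ i) f≡c) on-p)
  ...   | ()

  cycleEdges-noReversal : ∀ {z} (p : Walk z) → Simple p → ∀ j j' → cycleEdges p j ≢ i (cycleEdges p j')
  cycleEdges-noReversal start        _      zero    zero     e≡ie    = e-half (sym e≡ie)
  cycleEdges-noReversal (step f a p) _      zero    zero     if≡iif  =
    proj₁ a (trans if≡iif (i-invol f))
  cycleEdges-noReversal (step f a p) simple zero    (suc j') if≡ic   =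
    step-∉-cycleEdges simple j' (i-injective if≡ic)
  cycleEdges-noReversal (step f a p) simple (suc j) zero     c≡iif   =
    step-∉-cycleEdges simple j (sym (trans c≡iif (i-invol f)))
  cycleEdges-noReversal (step f a p) simple (suc j) (suc j') c≡ic    =
    cycleEdges-noReversal p (simple-tail simple) j j' c≡ic

  cycle : (q : Walk (r (i e))) → Simple q → Cycle (length q)
  cycle q simple = record
    { es       = cycleEdges q
    ; half     = cycleEdges-half q
    ; linked   = cycleEdges-linked q
    ; closed   = trans (cong (r ∘ i) (cycleEdges-last q)) (sym (trans (r-cycleEdges q zero) (trail-head q)))
    ; vtx-inj  = vtx-inj
    ; edge-inj = λ where
        j j' (inj₁ same)     → vtx-inj j j' (cong r same)
        j j' (inj₂ reversed) → ⊥-elim (cycleEdges-noReversal q simple j j' reversed)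
    }
    where
    vtx-inj : ∀ j j' → r (cycleEdges q j) ≡ r (cycleEdges q j') → j ≡ j'
    vtx-inj j j' eq = simple (trans (sym (r-cycleEdges q j)) (trans eq (r-cycleEdges q j')))

  -- Reachability from r e by a walk of length at most k, in a form that is decidable by recursion on k.
  WalkWithin : ℕ → Fin size → Set
  WalkWithin zero    z = z ≡ r e
  WalkWithin (suc k) z = WalkWithin k z ⊎ ∃ λ f → AvoidsE f × r (i f) ≡ z × WalkWithin k (r f)

  walkWithin? : ∀ k → Decidable (WalkWithin k)
  walkWithin? zero    z = z ≟ᶠ r e
  walkWithin? (suc k) z = walkWithin? k z
    ⊎-dec any? (λ f → avoidsE? f ×-dec r (i f) ≟ᶠ z ×-dec walkWithin? k (r f))

  walkWithin⇒walk : ∀ k {z} → WalkWithin k z → Walk z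
  walkWithin⇒walk zero    refl                        = start
  walkWithin⇒walk (suc k) (inj₁ w)                    = walkWithin⇒walk k w
  walkWithin⇒walk (suc k) (inj₂ (f , a , refl , w))  = step f a (walkWithin⇒walk k w)

  walk⇒walkWithin : ∀ {k z} (p : Walk z) → length p ℕ.≤ k → WalkWithin k z
  walk⇒walkWithin {zero}  start        _          = refl
  walk⇒walkWithin {suc k} start        _          = inj₁ (walk⇒walkWithin start z≤n)
  walk⇒walkWithin {suc k} (step f a p) (s≤s len≤k) = inj₂ (f , a , refl , walk⇒walkWithin p len≤k)

  walk⇒walkWithin-size : ∀ {z} → Walk z → WalkWithin size z
  walk⇒walkWithin-size p with shorten p
  ... | q , simple = walk⇒walkWithin q (ℕP.<⇒≤ (simple-length q simple))

  side : Fin size → Bool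
  side z = does (walkWithin? size z)

  side-root : side (r e) ≡ true
  side-root = dec-true (walkWithin? size (r e)) (walk⇒walkWithin-size start)

  -- A walk from r e back to r (i e) avoiding e would close up to a cycle.
  side-target : side (r (i e)) ≡ false
  side-target = dec-false (walkWithin? size (r (i e))) λ w →
    let (q , simple) = shorten (walkWithin⇒walk size w) in acyclic (length q , cycle q simple)

  side-across : ∀ {f} → AvoidsE f → side (r f) ≡ side (r (i f))
  side-across {f} a = does-⇔ (mk⇔ forth back) (walkWithin? size (r f)) (walkWithin? size (r (i f)))
    where
    forth : WalkWithin size (r f) → WalkWithin size (r (i f))
    forth w = walk⇒walkWithin-size (step f a (walkWithin⇒walk size w))
    back : WalkWithin size (r (i f)) → WalkWithin size (r f)
    back w = subst (WalkWithin size ∘ r) (i-invol f)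
      (walk⇒walkWithin-size (step (i f) (avoidsE-i a) (walkWithin⇒walk size w)))

module Pullback {c ℓ} (M : CommutativeMonoid c ℓ) (integral : IsIntegral M) (Γ T : MGraph M)
                (T-acyclic : ¬ MGraph.HasCycle T) (ψ : Morphism M Γ T) (harmonic : Morphism.Harmonic ψ) where
  open CommutativeMonoid M using (ε) renaming (refl to ≈-refl; sym to ≈-sym)
  module Γ = MGraph Γ
  module T = MGraph T
  open Morphism ψ
  open GraphFacts T using (i-halfEdge)
  open Groupification M integral
  open LinearEquivalence M integral Γ

  m : Fin Γ.size → ℤ
  m = proj₁ harmonic

  φ*[_] : Fin T.size → Γ.Div
  φ*[ a ] z = if φ z T.== a then m z else 0ℤ

  on-edge-at : ∀ {f e'} → Γ.IsHalfEdge f → T.IsHalfEdge e' → φ f ≡ e' →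
    φ (Γ.r f) ≡ T.r e' × φ (Γ.r (Γ.i f)) ≡ T.r (T.i e') × ιgp M (T.l e') ≈ᵍ zmul M (μ f) (Γ.l f)
  on-edge-at {f} f-half φf-half refl = on-edge f f-half φf-half

  mult≡φ* : ∀ v → Γ.IsVertex v → ∀ e' → T.IsHalfEdge e' → mult v e' ≡ φ*[ T.r e' ] v
  mult≡φ* v v-vertex e' e'-half with φ v ≟ᶠ T.r e'
  ... | yes φv≡re' = proj₂ harmonic v v-vertex e' e'-half (sym φv≡re')
  ... | no  φv≢re' = sumFin-zero Γ.size no-preimage
    where
    no-preimage : ∀ f →
      (if not (Γ.isVertex? f) ∧ (Γ.r f Γ.== v) ∧ (φ f T.== e') then μ f else 0ℤ) ≡ 0ℤ
    no-preimage f with Γ.i f ≟ᶠ f | Γ.r f ≟ᶠ v | φ f ≟ᶠ e'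
    ... | yes _      | _       | _     = refl
    ... | no _       | no _    | _     = refl
    ... | no _       | yes _   | no _  = refl
    ... | no f-half  | yes rf≡v | yes φf≡e' =
      ⊥-elim (φv≢re' (trans (cong φ (sym rf≡v)) (proj₁ (on-edge-at f-half e'-half φf≡e'))))

  module Cut (e' : Fin T.size) (e'-half : T.IsHalfEdge e') where
    open TreeSides T T-acyclic e' e'-half using (side; side-root; side-target; side-across)

    level : Bool → GP M
    level b = if b then ιgp M (T.l e') else ιgp M ε

    height : Fin T.size → GP M
    height a = level (side a)

    cutSlope : Fin Γ.size → ℤ
    cutSlope f = if φ f T.== e' then μ f else if φ f T.== T.i e' then - μ f else 0ℤ

    SlopeSpec : Fin Γ.size → ℤ → Set ℓ
    SlopeSpec f s = height (φ (Γ.r f)) -ᵍ height (φ (Γ.r (Γ.i f))) ≈ᵍ zmul M s (Γ.l f)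

    height-root : height (T.r e') ≡ ιgp M (T.l e')
    height-root = cong level side-root

    height-target : height (T.r (T.i e')) ≡ ιgp M ε
    height-target = cong level side-target

    along : ∀ f → Γ.IsHalfEdge f → φ f ≡ e' → SlopeSpec f (μ f)
    along f f-half φf≡e' with on-edge-at f-half e'-half φf≡e'
    ... | src , tgt , len = begin
      height (φ (Γ.r f)) -ᵍ height (φ (Γ.r (Γ.i f)))
        ≡⟨ cong₂ _-ᵍ_ (trans (cong height src) height-root) (trans (cong height tgt) height-target) ⟩
      ιgp M (T.l e') -ᵍ ιgp M ε   ≈⟨ -ᵍ-identityʳ _ ⟩
      ιgp M (T.l e')              ≈⟨ len ⟩
      zmul M (μ f) (Γ.l f)        ∎
      where open import Relation.Binary.Reasoning.Setoid gpSetoid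

    against : ∀ f → Γ.IsHalfEdge f → φ f ≡ T.i e' → SlopeSpec f (- μ f)
    against f f-half φf≡ie' with on-edge-at f-half (i-halfEdge e'-half) φf≡ie'
    ... | src , tgt , len = begin
      height (φ (Γ.r f)) -ᵍ height (φ (Γ.r (Γ.i f)))
        ≡⟨ cong₂ _-ᵍ_ (trans (cong height src) height-target)
                      (trans (cong height (trans tgt (cong T.r (T.i-invol e')))) height-root) ⟩
      ιgp M ε -ᵍ ιgp M (T.l e')          ≈⟨ -ᵍ-anticomm (ιgp M (T.l e')) (ιgp M ε) ⟩
      swap (ιgp M (T.l e') -ᵍ ιgp M ε)   ≈⟨ swap-cong (-ᵍ-identityʳ _) ⟩
      swap (ιgp M (T.l e'))              ≈⟨ swap-cong (≈⇒≈ᵍ (≈-sym (T.l-sym e')) ≈-refl) ⟩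
      swap (ιgp M (T.l (T.i e')))        ≈⟨ swap-cong len ⟩
      swap (zmul M (μ f) (Γ.l f))        ≡⟨ zmul-neg (μ f) (Γ.l f) ⟨
      zmul M (- μ f) (Γ.l f)             ∎
      where open import Relation.Binary.Reasoning.Setoid gpSetoid

    flat : ∀ f → height (φ (Γ.r f)) ≡ height (φ (Γ.r (Γ.i f))) → SlopeSpec f 0ℤ
    flat f same = begin
      height (φ (Γ.r f)) -ᵍ height (φ (Γ.r (Γ.i f)))  ≡⟨ cong (height (φ (Γ.r f)) -ᵍ_) same ⟨
      height (φ (Γ.r f)) -ᵍ height (φ (Γ.r f))        ≈⟨ -ᵍ-self _ ⟩
      ιgp M ε                                          ∎
      where open import Relation.Binary.Reasoning.Setoid gpSetoid

    cut-slope : ∀ f → Γ.IsHalfEdge f → SlopeSpec f (cutSlope f)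
    cut-slope f f-half with φ f ≟ᶠ e' | φ f ≟ᶠ T.i e' | T.i (φ f) ≟ᶠ φ f
    ... | yes φf≡e' | _          | _            = along f f-half φf≡e'
    ... | no _      | yes φf≡ie' | _            = against f f-half φf≡ie'
    ... | no _      | no _       | yes φf-vertex =
      flat f (cong height (trans (proj₁ contracted) (sym (proj₂ contracted))))
      where contracted = on-vert f f-half φf-vertex
    ... | no φf≢e'  | no φf≢ie'  | no φf-half   =
      flat f (trans (cong height (proj₁ ends))
               (trans (cong level (side-across (φf-half , φf≢e' , φf≢ie')))
                      (cong height (sym (proj₁ (proj₂ ends))))))
      where ends = on-edge f f-half φf-half

    cut : Γ.PL
    cut = record { g = height ∘ φ ; slope = cutSlope ; slope-spec = cut-slope }

    Laplacian-cut : ∀ v → Γ.IsVertex v → Γ.Laplacian cut v ≡ φ*[ T.r e' ] v - φ*[ T.r (T.i e') ] v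
    Laplacian-cut v v-vertex = begin
      Γ.Laplacian cut v                                        ≡⟨ sumFin-cong Γ.size split ⟩
      sumFin Γ.size (λ f → term e' f - term (T.i e') f)        ≡⟨ sumFin-- Γ.size (term e') (term (T.i e')) ⟩
      mult v e' - mult v (T.i e')                              ≡⟨ cong₂ _-_ (mult≡φ* v v-vertex e' e'-half)
                                                                    (mult≡φ* v v-vertex (T.i e') (i-halfEdge e'-half)) ⟩
      φ*[ T.r e' ] v - φ*[ T.r (T.i e') ] v                    ∎
      where
      open ≡-Reasoning
      term : Fin T.size → Fin Γ.size → ℤ
      term e'' f = if not (Γ.isVertex? f) ∧ (Γ.r f Γ.== v) ∧ (φ f T.== e'') then μ f else 0ℤ
      split : ∀ f → (if not (Γ.isVertex? f) ∧ (Γ.r f Γ.== v) then cutSlope f else 0ℤ)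
                    ≡ term e' f - term (T.i e') f
      split f with Γ.i f ≟ᶠ f | Γ.r f ≟ᶠ v
      ... | yes _ | _     = refl
      ... | no _  | no _  = refl
      ... | no _  | yes _ with φ f ≟ᶠ e' | φ f ≟ᶠ T.i e'
      ...   | yes φf≡e' | yes φf≡ie' = ⊥-elim (e'-half (trans (sym φf≡ie') φf≡e'))
      ...   | yes _     | no _       = sym (ℤP.+-identityʳ (μ f))
      ...   | no _      | yes _      = sym (ℤP.+-identityˡ (- μ f))
      ...   | no _      | no _       = refl

  φ*-across : ∀ e' → T.IsHalfEdge e' → φ*[ T.r e' ] Γ.∼ φ*[ T.r (T.i e') ]
  φ*-across e' e'-half = Cut.cut e' e'-half , λ v v-vertex → sym (Cut.Laplacian-cut e' e'-half v v-vertex)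

  φ*-reach : ∀ {w a} → T.Reach w a → φ*[ a ] Γ.∼ φ*[ w ]
  φ*-reach {w} T.here                    = ∼-refl φ*[ w ]
  φ*-reach (T.step h h-half w↝rh) = ∼-trans {φ*[ T.r (T.i h) ]} {φ*[ T.r h ]}
    (subst (λ x → φ*[ T.r (T.i h) ] Γ.∼ φ*[ T.r x ]) (T.i-invol h) (φ*-across (T.i h) (i-halfEdge h-half)))
    (φ*-reach w↝rh)

  deg-φ* : ∀ e' → T.IsHalfEdge e' → Γ.deg φ*[ T.r e' ] ≡
    sumFin Γ.size (λ v → if Γ.isVertex? v ∧ (φ v T.== T.r e') then mult v e' else 0ℤ)
  deg-φ* e' e'-half = sumFin-cong Γ.size termwise
    where
    termwise : ∀ v → (if Γ.isVertex? v then φ*[ T.r e' ] v else 0ℤ)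
                     ≡ (if Γ.isVertex? v ∧ (φ v T.== T.r e') then mult v e' else 0ℤ)
    termwise v with Γ.i v ≟ᶠ v
    ... | no _ = refl
    ... | yes v-vertex with φ v ≟ᶠ T.r e'
    ...   | yes φv≡re' = sym (proj₂ harmonic v v-vertex e' e'-half (sym φv≡re'))
    ...   | no _       = refl

  module _ (nondegenerate : Morphism.NonDegenerate ψ harmonic) where

    φ*-effective : ∀ a → Γ.Effective φ*[ a ]
    φ*-effective a z z-vertex with φ z ≟ᶠ a
    ... | yes _ = ℤP.<⇒≤ (nondegenerate z z-vertex)
    ... | no _  = ℤP.≤-refl

    φ*-minus-point-effective : ∀ {v F} → Γ.IsVertex v → F v ≡ 1ℤ → (∀ z → Γ.IsVertex z → z ≢ v → F z ≡ 0ℤ) →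
      Γ.Effective (φ*[ φ v ] Γ.-D F)
    φ*-minus-point-effective {v} {F} v-vertex Fv≡1 others≡0 z z-vertex with z ≟ᶠ v
    ... | yes refl = subst (λ k → 0ℤ ℤ.≤ k) (cong₂ _-_ (sym φ*-self) (sym Fv≡1))
                       (ℤP.i≤j⇒0≤j-i (ℤP.i<j⇒suc[i]≤j (nondegenerate v v-vertex)))
      where
      φ*-self : φ*[ φ v ] v ≡ m v
      φ*-self with φ v ≟ᶠ φ v
      ... | yes _ = refl
      ... | no φv≢φv = ⊥-elim (φv≢φv refl)
    ... | no z≢v = subst (λ k → 0ℤ ℤ.≤ k)
                     (trans (sym (ℤP.+-identityʳ _)) (cong (λ k → φ*[ φ v ] z - k) (sym (others≡0 z z-vertex z≢v))))
                     (φ*-effective (φ v) z z-vertex)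

theorem3p1 : ∀ {c ℓ} (M : CommutativeMonoid c ℓ) → IsSharp M → IsIntegral M →
  (Γ : MGraph M) → MGraph.Connected Γ →
  ∀ (d : ℤ) → GgonLe M Γ d → MGraph.DgonLe Γ d
theorem3p1 M _ integral Γ _ d (T , (T-connected , T-acyclic) , ψ , harmonic , nondegenerate , (e₀ , e₀-half) , degree) =
  φ*[ w ] , (1ℤ , ℤP.≤-refl , rank≥1) , ℤP.≤-reflexive (trans (deg-φ* e₀ e₀-half) (degree e₀ e₀-half))
  where
  open Pullback M integral Γ T T-acyclic ψ harmonic
  open Morphism ψ using (φ; vert)
  open LinearEquivalence M integral Γ using (∼-−-congʳ)
  open GraphFacts Γ using (effective-degree-one)

  w : Fin T.size
  w = T.r e₀

  rank≥1 : Γ.RankCond φ*[ w ] 1ℤ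
  rank≥1 F F≥0 degF≡1 with effective-degree-one F F≥0 degF≡1
  ... | v , v-vertex , Fv≡1 , others≡0 =
    φ*[ φ v ] Γ.-D F ,
    φ*-minus-point-effective nondegenerate v-vertex Fv≡1 others≡0 ,
    ∼-−-congʳ {φ*[ φ v ]} {φ*[ w ]} F (φ*-reach (T-connected w (φ v) (GraphFacts.r-vertex T e₀) (vert v v-vertex)))
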